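{- Consider an instance of the MaxThroughput problem for conservative $k$-of-$n$ testing. For $i\in\{1,\dots,n\}$ let $\pi_i=(i,i+1,\dots,n,1,2,\dots,i-1)$ and $T_i=T^c_k(\pi_i)$, and set $p_0:=p_n$. Let $N(a,b)=\sum_{\ell=a}^{b}(1-x_\ell)$ and $\alpha=\sum_{t=1}^{k}\Pr_{x\sim D_p}[N(1,n)\ge t]$. Any routing that assigns a total of $t$ units of flow to the strategies $T_i$, such that the fraction of the total assigned to each $T_i$ is $(1-p_{i-1})/\sum_{j=1}^n(1-p_{j-1})$, reduces each processor's residual capacity by $t\alpha/\sum_{j=1}^n(1-p_j)$ units (i.e., for every processor $O_\ell$, $\sum_i g(T_i,\ell)z_{T_i}=t\alpha/\sum_{j=1}^n(1-p_j)$). If all processors have the same rate limit $r$, then the routing that assigns $r(1-p_{i-1})/\alpha$ units of flow to strategy $T_i$ for each $i$ saturates all processors.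
   Context: Setting: there are $n$ binary tests $1,\dots,n$ applied to an item $x\in\{0,1\}^n$, where $x_i$ is the value of test $i$. Under the product distribution $D_p$, the $x_i$ are independent with $\Pr[x_i=1]=p_i$, where $0<p_i<1$. Fix $1\le k\le n$. The $k$-of-$n$ function is $f(x)=1$ iff $x$ contains fewer than $k$ zeros. A conservative $k$-of-$n$ testing strategy is a binary decision tree computing $f$ (internal nodes labeled by variables, left child for value 0, right child for value 1) such that every root-to-leaf path ending at a leaf labeled 1 contains exactly $n$ internal nodes with distinct labels. For a permutation $\pi$ of the tests, $T^c_k(\pi)$ is the conservative strategy: perform tests in order $\pi$ until $k$ zeros have been observed or all tests have been performed; output 0 in the first case, 1 in the second. For a strategy $T$, $g(T,i)$ is the probability that test $i$ is performed on $x\sim D_p$ when tested with $T$. Each test $i$ is performed by processor $O_i$ with rate limit $r_i>0$. The MaxThroughput problem for conservative $k$-of-$n$ testing is the LP: over variables $z_T\ge0$, one per conservative strategy $T$, maximize $\sum_T z_T$ subject to $\sum_T g(T,i)z_T\le r_i$ for all $i$. A routing is a feasible assignment; it saturates $O_i$ if $\sum_T g(T,i)z_T=r_i$. The amount by which a routing reduces the residual capacity of $O_i$ is $\sum_T g(T,i)z_T$.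
   Formalization: The probabilities $p_i$, the total flow $t$, the common rate limit $r$ and the flow amounts assigned to the strategies $T_i$ are rational. -}

module Defs where

open import Data.Bool using (Bool; true; false; if_then_else_)
open import Data.Nat as ℕ using (ℕ; zero; suc; _≤ᵇ_)
open import Data.Nat.DivMod using (_mod_)
open import Data.Fin as Fin using (Fin; toℕ)
open import Data.List using (List; []; _∷_; map; concatMap; upTo; foldr)
open import Data.Bool.ListAction using (any)
open import Data.Vec.Functional using (Vector) renaming (_∷_ to _∷ᵥ_)
open import Data.Rational using (ℚ; 0ℚ; 1ℚ; _+_; _*_; _-_)
open import Relation.Nullary using (does)

-- Tests are indexed 0..n-1 (paper's test j+1 is our Fin index j).
-- An item x ∈ {0,1}^n is a function Fin n → Bool (true = 1, false = 0).
Item : ℕ → Set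
Item n = Fin n → Bool

ΣFin : ∀ {n} → (Fin n → ℚ) → ℚ
ΣFin {zero} f = 0ℚ
ΣFin {suc n} f = f Fin.zero + ΣFin (λ i → f (Fin.suc i))

ΠFin : ∀ {n} → (Fin n → ℚ) → ℚ
ΠFin {zero} f = 1ℚ
ΠFin {suc n} f = f Fin.zero * ΠFin (λ i → f (Fin.suc i))

sumList : List ℚ → ℚ
sumList = foldr _+_ 0ℚ

allItems : (n : ℕ) → List (Item n)
allItems zero = (λ ()) ∷ []
allItems (suc n) =
  concatMap (λ b → map (λ x → b ∷ᵥ x) (allItems n)) (false ∷ true ∷ [])

weight : ∀ {n} → (Fin n → ℚ) → Item n → ℚ
weight p x = ΠFin (λ i → if x i then p i else 1ℚ - p i)

Pr : ∀ {n} → (Fin n → ℚ) → (Item n → Bool) → ℚ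
Pr {n} p E = sumList (map (λ x → if E x then weight p x else 0ℚ) (allItems n))

numZeros : ∀ {n} → Item n → ℕ
numZeros {zero} x = zero
numZeros {suc n} x = (if x Fin.zero then 0 else 1) ℕ.+ numZeros (λ i → x (Fin.suc i))

alpha : ∀ {n} → (Fin n → ℚ) → ℕ → ℚ
alpha p k = sumList (map (λ t → Pr p (λ x → suc t ≤ᵇ numZeros x)) (upTo k))

-- The tests performed by the conservative strategy T^c_k(π) on item x:
-- perform tests in order π until k zeros have been observed (or the
-- list is exhausted).  The ℕ argument is the number of zeros still
-- allowed before stopping.
performed : ∀ {n} → Item n → ℕ → List (Fin n) → List (Fin n)
performed x zero    js       = []
performed x (suc m) []       = []
performed x (suc m) (j ∷ js) =
  j ∷ (if x j then performed x (suc m) js else performed x m js)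

g : ∀ {n} → (Fin n → ℚ) → ℕ → List (Fin n) → Fin n → ℚ
g p k π ℓ = Pr p (λ x → any (λ j → does (j Fin.≟ ℓ)) (performed x k π))

cyc : ∀ {n} → Fin n → ℕ → Fin n
cyc {suc m} i d = (toℕ i ℕ.+ d) mod (suc m)

-- π_i = (i, i+1, ..., n, 1, ..., i-1) (0-indexed: i, i+1, ..., n-1, 0, ..., i-1).
cycOrder : ∀ {n} → Fin n → List (Fin n)
cycOrder {n} i = map (cyc i) (upTo n)

-- Cyclic predecessor: prev of the first test is the last test (p_0 := p_n).
prev : ∀ {n} → Fin n → Fin n
prev {suc m} i = cyc i m

module Submission where

-- Fix a processor ℓ.  The heart of the proof is the load identity
--   Σ_i g(T_i, ℓ) (1 - p_{i-1}) = α ,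
-- from which both claims follow by linear algebra (the second one after
-- cancelling α > 0).  The identity is obtained in three steps.
--   * Independence: test i-1 is the last test of π_i, so whether ℓ is
--     performed by T_i does not depend on x_{i-1}; hence
--     g(T_i, ℓ)(1 - p_{i-1}) = Pr[x_{i-1} = 0 and T_i performs ℓ].
--   * Counting: for every fixed item x with N zeros,
--     #{ i : x_{i-1} = 0 and T_i performs ℓ } = Σ_{t<k} [t < N].
--     This is proved by induction on k: passing from k to k+1 changes the
--     left-hand side by a telescoping sum over the cyclic shift i ↦ i-1
--     plus the single term [i-1 = ℓ][k < N].
--   * Linearity of expectation turns the counting identity into α.

open import Defs
open import Data.Nat using (ℕ; _≤_)
open import Data.Fin using (Fin)
open import Data.Product using (_×_)
open import Data.Rational using (ℚ; 0ℚ; 1ℚ; _+_; _*_; _-_; _<_) renaming (_≤_ to _≤ℚ_)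
open import Relation.Binary.PropositionalEquality using (_≡_)

open import Algebra.Bundles using (CommutativeRing)
open import Data.Bool using (Bool; true; false; if_then_else_; not; _∧_; _∨_)
import Data.Bool.Properties as BoolP
open import Data.Bool.ListAction using (any)
open import Data.Empty using (⊥-elim)
open import Data.Fin using (zero; suc; toℕ; _≟_)
import Data.Fin.Properties as FinP
open import Data.Fin.Permutation using (Permutation; permutation)
open import Data.List using (List; []; _∷_; _++_; [_]; map; upTo; applyUpTo; tabulate)
import Data.List.Properties as ListP
open import Data.List.Relation.Unary.All as All using (All; []; _∷_)
open import Data.List.Relation.Unary.All.Properties using (applyUpTo⁺₁)
import Data.Nat as ℕ
open import Data.Nat using (zero; suc; _<ᵇ_; _≤ᵇ_; _%_; _∸_)
import Data.Nat.Properties as ℕP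
open import Data.Nat.DivMod using (%-distribˡ-+; m%n%n≡m%n; [m+n]%n≡m%n; m<n⇒m%n≡m)
open import Data.Product using (_,_)
import Data.Rational as ℚ
import Data.Rational.Properties as ℚP
open import Data.Rational.Solver using (module +-*-Solver)
open import Data.Vec.Functional using () renaming (_∷_ to _∷ᵥ_)
open import Relation.Binary.PropositionalEquality
  using (refl; sym; trans; cong; cong₂; subst; _≢_; module ≡-Reasoning)
open import Relation.Nullary using (does; yes; no)

open import Algebra.Properties.Group ℚP.+-0-group using (∙-cancelʳ)
open import Algebra.Properties.Semiring.Sum (CommutativeRing.semiring ℚP.+-*-commutativeRing)
  using (sum; sum-syntax; sum-cong-≗; ∑-distrib-+; *-distribˡ-sum; *-distribʳ-sum;
         sum-replicate-zero; sum-permute)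
open import Algebra.Properties.CommutativeSemigroup ℕP.+-commutativeSemigroup using (x∙yz≈y∙xz)
open +-*-Solver using (solve; _:+_; _:-_; _:*_; _:=_; con)
open ≡-Reasoning

ind : Bool → ℚ
ind b = if b then 1ℚ else 0ℚ

ind-∧ : ∀ a b → ind (a ∧ b) ≡ ind a * ind b
ind-∧ true  b = sym (ℚP.*-identityˡ (ind b))
ind-∧ false b = sym (ℚP.*-zeroˡ (ind b))

*-exchange : ∀ a b c → a * (b * c) ≡ b * (a * c)
*-exchange = solve 3 (λ a b c → a :* (b :* c) := b :* (a :* c)) refl

*-nonneg : ∀ {a b} → 0ℚ ≤ℚ a → 0ℚ ≤ℚ b → 0ℚ ≤ℚ a * b
*-nonneg {a} {b} 0≤a 0≤b = ℚP.nonNegative⁻¹ (a * b)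
  {{ℚP.nonNeg*nonNeg⇒nonNeg a {{ℚ.nonNegative 0≤a}} b {{ℚ.nonNegative 0≤b}}}}

0<1-p : ∀ {p} → p < 1ℚ → 0ℚ < 1ℚ - p
0<1-p {p} p<1 = subst (_< 1ℚ - p) (ℚP.+-inverseʳ p) (ℚP.+-monoˡ-< (ℚ.- p) p<1)

*-cancelʳ-≢0 : ∀ {a b} c → c ≢ 0ℚ → a * c ≡ b * c → a ≡ b
*-cancelʳ-≢0 {a} {b} c c≢0 ac≡bc = begin
  a                  ≡⟨ sym (ℚP.*-identityʳ a) ⟩
  a * 1ℚ             ≡⟨ cong (a *_) (sym (ℚP.*-inverseʳ c)) ⟩
  a * (c * ℚ.1/ c)   ≡⟨ sym (ℚP.*-assoc a c (ℚ.1/ c)) ⟩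
  a * c * ℚ.1/ c     ≡⟨ cong (_* ℚ.1/ c) ac≡bc ⟩
  b * c * ℚ.1/ c     ≡⟨ ℚP.*-assoc b c (ℚ.1/ c) ⟩
  b * (c * ℚ.1/ c)   ≡⟨ cong (b *_) (ℚP.*-inverseʳ c) ⟩
  b * 1ℚ             ≡⟨ ℚP.*-identityʳ b ⟩
  b                  ∎
  where
  instance
    c-nonZero : ℚ.NonZero c
    c-nonZero = ℚ.≢-nonZero c≢0

ΣFin≡sum : ∀ {n} (f : Fin n → ℚ) → ΣFin f ≡ sum f
ΣFin≡sum {zero}  f = refl
ΣFin≡sum {suc n} f = cong (f zero +_) (ΣFin≡sum (λ i → f (suc i)))

sum-indicator : ∀ {n} (ℓ : Fin n) c → ∑[ j < n ] ind (does (j ≟ ℓ) ∧ c) ≡ ind c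
sum-indicator {suc n} zero    c =
  trans (cong (ind c +_) (sum-replicate-zero n)) (ℚP.+-identityʳ (ind c))
sum-indicator {suc n} (suc ℓ) c = trans (ℚP.+-identityˡ _) (sum-indicator ℓ c)

sumList-++ : ∀ (xs ys : List ℚ) → sumList (xs ++ ys) ≡ sumList xs + sumList ys
sumList-++ []       ys = sym (ℚP.+-identityˡ (sumList ys))
sumList-++ (x ∷ xs) ys = trans (cong (x +_) (sumList-++ xs ys)) (sym (ℚP.+-assoc x _ _))

module _ {A : Set} where

  sumList-map-cong : ∀ {f g : A → ℚ} → (∀ a → f a ≡ g a) → ∀ L →
                     sumList (map f L) ≡ sumList (map g L)
  sumList-map-cong f≗g L = cong sumList (ListP.map-cong f≗g L)

  sumList-map-+ : ∀ (f g : A → ℚ) L →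
                  sumList (map (λ a → f a + g a) L) ≡ sumList (map f L) + sumList (map g L)
  sumList-map-+ f g []      = refl
  sumList-map-+ f g (a ∷ L) =
    trans (cong (f a + g a +_) (sumList-map-+ f g L))
          (solve 4 (λ u v s t → (u :+ v) :+ (s :+ t) := (u :+ s) :+ (v :+ t)) refl (f a) (g a) _ _)

  sumList-map-scale : ∀ c (f : A → ℚ) L → sumList (map (λ a → c * f a) L) ≡ c * sumList (map f L)
  sumList-map-scale c f []      = sym (ℚP.*-zeroʳ c)
  sumList-map-scale c f (a ∷ L) =
    trans (cong (c * f a +_) (sumList-map-scale c f L)) (sym (ℚP.*-distribˡ-+ c (f a) _))

  sumList-map-nonneg : ∀ (f : A → ℚ) → (∀ a → 0ℚ ≤ℚ f a) → ∀ L → 0ℚ ≤ℚ sumList (map f L)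
  sumList-map-nonneg f 0≤f []      = ℚP.≤-refl
  sumList-map-nonneg f 0≤f (a ∷ L) = ℚP.+-mono-≤ (0≤f a) (sumList-map-nonneg f 0≤f L)

sumList-upTo-suc : ∀ (h : ℕ → ℚ) k →
                   sumList (map h (upTo (suc k))) ≡ sumList (map h (upTo k)) + h k
sumList-upTo-suc h k = begin
  sumList (map h (upTo (suc k)))         ≡⟨ cong (λ l → sumList (map h l)) (ListP.upTo-∷ʳ k) ⟨
  sumList (map h (upTo k ++ [ k ]))      ≡⟨ cong sumList (ListP.map-++ h (upTo k) [ k ]) ⟩
  sumList (map h (upTo k) ++ [ h k ])    ≡⟨ sumList-++ (map h (upTo k)) [ h k ] ⟩
  sumList (map h (upTo k)) + (h k + 0ℚ) ≡⟨ cong (sumList (map h (upTo k)) +_) (ℚP.+-identityʳ (h k)) ⟩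
  sumList (map h (upTo k)) + h k         ∎

Ex : ∀ {n} → (Fin n → ℚ) → (Item n → ℚ) → ℚ
Ex {n} p f = sumList (map (λ x → f x * weight p x) (allItems n))

Pr≡Ex : ∀ {n} (p : Fin n → ℚ) (E : Item n → Bool) → Pr p E ≡ Ex p (λ x → ind (E x))
Pr≡Ex {n} p E = sumList-map-cong if≡ind (allItems n)
  where
  if≡ind : ∀ x → (if E x then weight p x else 0ℚ) ≡ ind (E x) * weight p x
  if≡ind x with E x
  ... | true  = sym (ℚP.*-identityˡ (weight p x))
  ... | false = sym (ℚP.*-zeroˡ (weight p x))

module _ {n} (p : Fin n → ℚ) where

  Ex-cong : ∀ {f g : Item n → ℚ} → (∀ x → f x ≡ g x) → Ex p f ≡ Ex p g
  Ex-cong f≗g = sumList-map-cong (λ x → cong (_* weight p x) (f≗g x)) (allItems n)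

  Ex-zero : Ex p (λ _ → 0ℚ) ≡ 0ℚ
  Ex-zero = trans (sumList-map-scale 0ℚ (weight p) (allItems n))
                  (ℚP.*-zeroˡ (sumList (map (weight p) (allItems n))))

  Ex-+ : ∀ (f g : Item n → ℚ) → Ex p (λ x → f x + g x) ≡ Ex p f + Ex p g
  Ex-+ f g =
    trans (sumList-map-cong (λ x → ℚP.*-distribʳ-+ (weight p x) (f x) (g x)) (allItems n))
          (sumList-map-+ (λ x → f x * weight p x) (λ x → g x * weight p x) (allItems n))

  Ex-∑ : ∀ m (f : Fin m → Item n → ℚ) →
         ∑[ i < m ] Ex p (f i) ≡ Ex p (λ x → ∑[ i < m ] f i x)
  Ex-∑ zero    f = sym Ex-zero
  Ex-∑ (suc m) f = trans (cong (Ex p (f zero) +_) (Ex-∑ m (λ i → f (suc i))))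
                         (sym (Ex-+ (f zero) (λ x → ∑[ i < m ] f (suc i) x)))

  Ex-sumList : ∀ {A : Set} (L : List A) (f : A → Item n → ℚ) →
               sumList (map (λ t → Ex p (f t)) L) ≡ Ex p (λ x → sumList (map (λ t → f t x) L))
  Ex-sumList []      f = sym Ex-zero
  Ex-sumList (t ∷ L) f = trans (cong (Ex p (f t) +_) (Ex-sumList L f))
                               (sym (Ex-+ (f t) (λ x → sumList (map (λ t → f t x) L))))

Ex-cons : ∀ {n} (p : Fin (suc n) → ℚ) (f : Item (suc n) → ℚ) →
          Ex p f ≡ (1ℚ - p zero) * Ex (λ i → p (suc i)) (λ y → f (false ∷ᵥ y))
                   + p zero * Ex (λ i → p (suc i)) (λ y → f (true ∷ᵥ y))
Ex-cons {n} p f = begin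
  sumList (map h (map (false ∷ᵥ_) L ++ (map (true ∷ᵥ_) L ++ [])))
    ≡⟨ cong sumList (ListP.map-++ h (map (false ∷ᵥ_) L) (map (true ∷ᵥ_) L ++ [])) ⟩
  sumList (map h (map (false ∷ᵥ_) L) ++ map h (map (true ∷ᵥ_) L ++ []))
    ≡⟨ sumList-++ (map h (map (false ∷ᵥ_) L)) (map h (map (true ∷ᵥ_) L ++ [])) ⟩
  sumList (map h (map (false ∷ᵥ_) L)) + sumList (map h (map (true ∷ᵥ_) L ++ []))
    ≡⟨ cong₂ _+_ (branch false)
                 (trans (cong (λ l → sumList (map h l)) (ListP.++-identityʳ (map (true ∷ᵥ_) L)))
                        (branch true)) ⟩
  (1ℚ - p zero) * Ex p′ (λ y → f (false ∷ᵥ y)) + p zero * Ex p′ (λ y → f (true ∷ᵥ y))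
    ∎
  where
  L : List (Item n)
  L = allItems n
  p′ : Fin n → ℚ
  p′ i = p (suc i)
  h : Item (suc n) → ℚ
  h x = f x * weight p x
  q : Bool → ℚ
  q b = if b then p zero else 1ℚ - p zero
  branch : ∀ b → sumList (map h (map (b ∷ᵥ_) L)) ≡ q b * Ex p′ (λ y → f (b ∷ᵥ y))
  branch b = begin
    sumList (map h (map (b ∷ᵥ_) L))
      ≡⟨ cong sumList (sym (ListP.map-∘ L)) ⟩
    sumList (map (λ y → f (b ∷ᵥ y) * (q b * weight p′ y)) L)
      ≡⟨ sumList-map-cong (λ y → *-exchange (f (b ∷ᵥ y)) (q b) (weight p′ y)) L ⟩
    sumList (map (λ y → q b * (f (b ∷ᵥ y) * weight p′ y)) L)
      ≡⟨ sumList-map-scale (q b) (λ y → f (b ∷ᵥ y) * weight p′ y) L ⟩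
    q b * Ex p′ (λ y → f (b ∷ᵥ y))
      ∎

Ex-one : ∀ {n} (p : Fin n → ℚ) → Ex p (λ _ → 1ℚ) ≡ 1ℚ
Ex-one {zero}  p = refl
Ex-one {suc n} p = begin
  Ex p (λ _ → 1ℚ)
    ≡⟨ Ex-cons p (λ _ → 1ℚ) ⟩
  (1ℚ - p zero) * Ex p′ (λ _ → 1ℚ) + p zero * Ex p′ (λ _ → 1ℚ)
    ≡⟨ cong (λ e → (1ℚ - p zero) * e + p zero * e) (Ex-one p′) ⟩
  (1ℚ - p zero) * 1ℚ + p zero * 1ℚ
    ≡⟨ solve 1 (λ q → (con 1ℚ :- q) :* con 1ℚ :+ q :* con 1ℚ := con 1ℚ) refl (p zero) ⟩
  1ℚ
    ∎
  where
  p′ : Fin n → ℚ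
  p′ i = p (suc i)

Ex-nonneg : ∀ {n} (p : Fin n → ℚ) → (∀ i → 0ℚ ≤ℚ p i) → (∀ i → 0ℚ ≤ℚ 1ℚ - p i) →
            ∀ f → (∀ x → 0ℚ ≤ℚ f x) → 0ℚ ≤ℚ Ex p f
Ex-nonneg {zero}  p _ _ f 0≤f =
  subst (0ℚ ≤ℚ_) (sym (trans (ℚP.+-identityʳ (f x₀ * 1ℚ)) (ℚP.*-identityʳ (f x₀)))) (0≤f x₀)
  where
  x₀ : Item 0
  x₀ = λ ()
Ex-nonneg {suc n} p 0≤p 0≤1-p f 0≤f = subst (0ℚ ≤ℚ_) (sym (Ex-cons p f))
  (ℚP.+-mono-≤ (*-nonneg (0≤1-p zero) (tail-nonneg false))
               (*-nonneg (0≤p zero) (tail-nonneg true)))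
  where
  tail-nonneg : ∀ b → 0ℚ ≤ℚ Ex (λ i → p (suc i)) (λ y → f (b ∷ᵥ y))
  tail-nonneg b = Ex-nonneg (λ i → p (suc i)) (λ i → 0≤p (suc i)) (λ i → 0≤1-p (suc i))
                            (λ y → f (b ∷ᵥ y)) (λ y → 0≤f (b ∷ᵥ y))

Ex-ind-nonneg : ∀ {n} (p : Fin n → ℚ) → (∀ i → 0ℚ ≤ℚ p i) → (∀ i → 0ℚ ≤ℚ 1ℚ - p i) →
                ∀ (E : Item n → Bool) → 0ℚ ≤ℚ Ex p (λ x → ind (E x))
Ex-ind-nonneg p 0≤p 0≤1-p E = Ex-nonneg p 0≤p 0≤1-p (λ x → ind (E x)) ind-nonneg
  where
  ind-nonneg : ∀ x → 0ℚ ≤ℚ ind (E x)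
  ind-nonneg x with E x
  ... | true  = ℚP.nonNegative⁻¹ 1ℚ
  ... | false = ℚP.≤-refl

Ex-indep : ∀ {n} (p : Fin n → ℚ) (j : Fin n) (f : Item n → ℚ) →
           (∀ x y → (∀ i → i ≢ j → x i ≡ y i) → f x ≡ f y) →
           Ex p (λ x → ind (not (x j)) * f x) ≡ (1ℚ - p j) * Ex p f
Ex-indep {suc n} p zero f ignores-j = begin
  Ex p (λ x → ind (not (x zero)) * f x)
    ≡⟨ Ex-cons p (λ x → ind (not (x zero)) * f x) ⟩
  (1ℚ - p zero) * Ex p′ (λ y → 1ℚ * f (false ∷ᵥ y))
    + p zero * Ex p′ (λ y → 0ℚ * f (true ∷ᵥ y))
    ≡⟨ cong₂ (λ u v → (1ℚ - p zero) * u + p zero * v)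
             (Ex-cong p′ (λ y → ℚP.*-identityˡ (f (false ∷ᵥ y))))
             (trans (Ex-cong p′ (λ y → ℚP.*-zeroˡ (f (true ∷ᵥ y)))) (Ex-zero p′)) ⟩
  (1ℚ - p zero) * A + p zero * 0ℚ
    ≡⟨ solve 2 (λ q a → (con 1ℚ :- q) :* a :+ q :* con 0ℚ
                      := (con 1ℚ :- q) :* ((con 1ℚ :- q) :* a :+ q :* a))
             refl (p zero) A ⟩
  (1ℚ - p zero) * ((1ℚ - p zero) * A + p zero * A)
    ≡⟨ cong (λ v → (1ℚ - p zero) * ((1ℚ - p zero) * A + p zero * v))
            (Ex-cong p′ flip-first) ⟩
  (1ℚ - p zero) * ((1ℚ - p zero) * A + p zero * Ex p′ (λ y → f (true ∷ᵥ y)))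
    ≡⟨ cong ((1ℚ - p zero) *_) (sym (Ex-cons p f)) ⟩
  (1ℚ - p zero) * Ex p f
    ∎
  where
  p′ : Fin n → ℚ
  p′ i = p (suc i)
  A : ℚ
  A = Ex p′ (λ y → f (false ∷ᵥ y))
  flip-first : ∀ y → f (false ∷ᵥ y) ≡ f (true ∷ᵥ y)
  flip-first y = ignores-j (false ∷ᵥ y) (true ∷ᵥ y) agree
    where
    agree : ∀ i → i ≢ zero → (false ∷ᵥ y) i ≡ (true ∷ᵥ y) i
    agree zero    i≢0 = ⊥-elim (i≢0 refl)
    agree (suc i) _   = refl
Ex-indep {suc n} p (suc j) f ignores-j = begin
  Ex p (λ x → ind (not (x (suc j))) * f x)
    ≡⟨ Ex-cons p (λ x → ind (not (x (suc j))) * f x) ⟩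
  (1ℚ - p zero) * Ex p′ (λ y → ind (not (y j)) * f (false ∷ᵥ y))
    + p zero * Ex p′ (λ y → ind (not (y j)) * f (true ∷ᵥ y))
    ≡⟨ cong₂ (λ u v → (1ℚ - p zero) * u + p zero * v)
             (Ex-indep p′ j (λ y → f (false ∷ᵥ y)) (ignores-j-after false))
             (Ex-indep p′ j (λ y → f (true ∷ᵥ y)) (ignores-j-after true)) ⟩
  (1ℚ - p zero) * ((1ℚ - p (suc j)) * A) + p zero * ((1ℚ - p (suc j)) * B)
    ≡⟨ solve 4 (λ q r a b → (con 1ℚ :- q) :* ((con 1ℚ :- r) :* a) :+ q :* ((con 1ℚ :- r) :* b)
                         := (con 1ℚ :- r) :* ((con 1ℚ :- q) :* a :+ q :* b))
             refl (p zero) (p (suc j)) A B ⟩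
  (1ℚ - p (suc j)) * ((1ℚ - p zero) * A + p zero * B)
    ≡⟨ cong ((1ℚ - p (suc j)) *_) (sym (Ex-cons p f)) ⟩
  (1ℚ - p (suc j)) * Ex p f
    ∎
  where
  p′ : Fin n → ℚ
  p′ i = p (suc i)
  A B : ℚ
  A = Ex p′ (λ y → f (false ∷ᵥ y))
  B = Ex p′ (λ y → f (true ∷ᵥ y))
  ignores-j-after : ∀ b x y → (∀ i → i ≢ j → x i ≡ y i) → f (b ∷ᵥ x) ≡ f (b ∷ᵥ y)
  ignores-j-after b x y agree = ignores-j (b ∷ᵥ x) (b ∷ᵥ y) agree′
    where
    agree′ : ∀ i → i ≢ suc j → (b ∷ᵥ x) i ≡ (b ∷ᵥ y) i
    agree′ zero    _      = refl
    agree′ (suc i) i≢1+j = agree i (λ i≡j → i≢1+j (cong suc i≡j))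

zeroBit : Bool → ℕ
zeroBit b = if b then 0 else 1

zerosIn : ∀ {n} → Item n → List (Fin n) → ℕ
zerosIn x []       = 0
zerosIn x (j ∷ js) = zeroBit (x j) ℕ.+ zerosIn x js

zerosIn-snoc : ∀ {n} (x : Item n) L j → zerosIn x (L ++ [ j ]) ≡ zerosIn x L ℕ.+ zeroBit (x j)
zerosIn-snoc x []      j = ℕP.+-identityʳ (zeroBit (x j))
zerosIn-snoc x (a ∷ L) j =
  trans (cong (zeroBit (x a) ℕ.+_) (zerosIn-snoc x L j))
        (sym (ℕP.+-assoc (zeroBit (x a)) (zerosIn x L) (zeroBit (x j))))

zerosIn-tabulate : ∀ {n k} (x : Item n) (f : Fin k → Fin n) →
                   zerosIn x (tabulate f) ≡ numZeros (λ i → x (f i))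
zerosIn-tabulate {k = zero}  x f = refl
zerosIn-tabulate {k = suc k} x f =
  cong (zeroBit (x (f zero)) ℕ.+_) (zerosIn-tabulate x (λ i → f (suc i)))

zerosIn-local : ∀ {n} (x y : Item n) L → All (λ j → x j ≡ y j) L →
                zerosIn x L ≡ zerosIn y L
zerosIn-local x y []      []             = refl
zerosIn-local x y (j ∷ L) (xj≡yj ∷ agree) =
  cong₂ ℕ._+_ (cong zeroBit xj≡yj) (zerosIn-local x y L agree)

performed-local : ∀ {n} (x y : Item n) k L → All (λ j → x j ≡ y j) L →
                  performed x k L ≡ performed y k L
performed-local x y zero    L       _                = refl
performed-local x y (suc k) []      _                = refl
performed-local x y (suc k) (j ∷ L) (xj≡yj ∷ agree) rewrite xj≡yj with y j
... | true  = cong (j ∷_) (performed-local x y (suc k) L agree)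
... | false = cong (j ∷_) (performed-local x y k L agree)

hits-cons : ∀ {n} (f : Fin n → Bool) (x : Item n) k j L →
            any f (performed x (suc k) (j ∷ L))
            ≡ f j ∨ (if x j then any f (performed x (suc k) L) else any f (performed x k L))
hits-cons f x k j L with x j
... | true  = refl
... | false = refl

performed-[] : ∀ {n} (x : Item n) k → performed x k [] ≡ []
performed-[] x zero    = refl
performed-[] x (suc k) = refl

hits-snoc : ∀ {n} (f : Fin n → Bool) (x : Item n) k L j →
            any f (performed x k (L ++ [ j ]))
            ≡ any f (performed x k L) ∨ (f j ∧ (zerosIn x L <ᵇ k))
hits-snoc f x zero    L       j = sym (BoolP.∧-zeroʳ (f j))
hits-snoc f x (suc k) []      j with x j
... | true  = trans (BoolP.∨-identityʳ (f j)) (sym (BoolP.∧-identityʳ (f j)))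
... | false = trans (cong (λ l → f j ∨ any f l) (performed-[] x k))
                    (trans (BoolP.∨-identityʳ (f j)) (sym (BoolP.∧-identityʳ (f j))))
hits-snoc f x (suc k) (a ∷ L) j with x a
... | true  = trans (cong (f a ∨_) (hits-snoc f x (suc k) L j)) (sym (BoolP.∨-assoc (f a) _ _))
... | false = trans (cong (f a ∨_) (hits-snoc f x k L j))       (sym (BoolP.∨-assoc (f a) _ _))

hits-outside : ∀ {n} (f : Fin n → Bool) (x : Item n) k L →
               any f L ≡ false → any f (performed x k L) ≡ false
hits-outside f x zero    L       _ = refl
hits-outside f x (suc k) []      _ = refl
hits-outside f x (suc k) (j ∷ L) none with f j | x j
... | true  | _     = none
... | false | true  = hits-outside f x (suc k) L none
... | false | false = hits-outside f x k L none

any-≟-false : ∀ {n} (ℓ : Fin n) {L} → All (_≢ ℓ) L → any (λ j → does (j ≟ ℓ)) L ≡ false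
any-≟-false ℓ []                   = refl
any-≟-false ℓ {j ∷ L} (j≢ℓ ∷ others) with j ≟ ℓ
... | yes j≡ℓ = ⊥-elim (j≢ℓ j≡ℓ)
... | no  _   = any-≟-false ℓ others

≟-sound : ∀ {n} (j ℓ : Fin n) → does (j ≟ ℓ) ≡ true → j ≡ ℓ
≟-sound j ℓ found with j ≟ ℓ
≟-sound j ℓ found  | yes j≡ℓ = j≡ℓ
≟-sound j ℓ ()     | no  _

applyUpTo-tabulate : ∀ {A : Set} (f : ℕ → A) k →
                     applyUpTo f k ≡ tabulate (λ (i : Fin k) → f (toℕ i))
applyUpTo-tabulate f zero    = refl
applyUpTo-tabulate f (suc k) = cong (f 0 ∷_) (applyUpTo-tabulate (λ d → f (suc d)) k)

-- Cyclic orders of n = suc m tests: cyc i d is test i + d (mod n),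
-- π_i = cycOrder i and prev i is the last test of π_i.
module _ {m : ℕ} where

  private
    n : ℕ
    n = suc m

  toℕ-cyc : ∀ (i : Fin n) d → toℕ (cyc i d) ≡ (toℕ i ℕ.+ d) % n
  toℕ-cyc i d = FinP.toℕ-fromℕ< _

  %-absorbˡ : ∀ a b → (a % n ℕ.+ b) % n ≡ (a ℕ.+ b) % n
  %-absorbˡ a b = begin
    (a % n ℕ.+ b) % n          ≡⟨ %-distribˡ-+ (a % n) b n ⟩
    (a % n % n ℕ.+ b % n) % n  ≡⟨ cong (λ u → (u ℕ.+ b % n) % n) (m%n%n≡m%n a n) ⟩
    (a % n ℕ.+ b % n) % n      ≡⟨ %-distribˡ-+ a b n ⟨
    (a ℕ.+ b) % n              ∎

  cyc-cyc : ∀ (i : Fin n) a b → cyc (cyc i a) b ≡ cyc i (a ℕ.+ b)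
  cyc-cyc i a b = FinP.toℕ-injective (begin
    toℕ (cyc (cyc i a) b)            ≡⟨ toℕ-cyc (cyc i a) b ⟩
    (toℕ (cyc i a) ℕ.+ b) % n        ≡⟨ cong (λ u → (u ℕ.+ b) % n) (toℕ-cyc i a) ⟩
    ((toℕ i ℕ.+ a) % n ℕ.+ b) % n    ≡⟨ %-absorbˡ (toℕ i ℕ.+ a) b ⟩
    (toℕ i ℕ.+ a ℕ.+ b) % n          ≡⟨ cong (_% n) (ℕP.+-assoc (toℕ i) a b) ⟩
    (toℕ i ℕ.+ (a ℕ.+ b)) % n        ≡⟨ toℕ-cyc i (a ℕ.+ b) ⟨
    toℕ (cyc i (a ℕ.+ b))            ∎)

  cyc-period : ∀ (i : Fin n) d → cyc i (d ℕ.+ n) ≡ cyc i d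
  cyc-period i d = FinP.toℕ-injective (begin
    toℕ (cyc i (d ℕ.+ n))       ≡⟨ toℕ-cyc i (d ℕ.+ n) ⟩
    (toℕ i ℕ.+ (d ℕ.+ n)) % n   ≡⟨ cong (_% n) (ℕP.+-assoc (toℕ i) d n) ⟨
    (toℕ i ℕ.+ d ℕ.+ n) % n     ≡⟨ [m+n]%n≡m%n (toℕ i ℕ.+ d) n ⟩
    (toℕ i ℕ.+ d) % n           ≡⟨ toℕ-cyc i d ⟨
    toℕ (cyc i d)               ∎)

  cyc-identity : ∀ (i : Fin n) → cyc i 0 ≡ i
  cyc-identity i = FinP.toℕ-injective (begin
    toℕ (cyc i 0)         ≡⟨ toℕ-cyc i 0 ⟩
    (toℕ i ℕ.+ 0) % n     ≡⟨ cong (_% n) (ℕP.+-identityʳ (toℕ i)) ⟩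
    toℕ i % n             ≡⟨ m<n⇒m%n≡m (FinP.toℕ<n i) ⟩
    toℕ i                 ∎)

  cyc-from-zero : ∀ (i : Fin n) → cyc zero (toℕ i) ≡ i
  cyc-from-zero i = FinP.toℕ-injective (trans (toℕ-cyc zero (toℕ i)) (m<n⇒m%n≡m (FinP.toℕ<n i)))

  cyc-unshift : ∀ (i : Fin n) {d} → d ℕ.< n → toℕ (cyc (cyc i d) (n ∸ toℕ i)) ≡ d
  cyc-unshift i {d} d<n = begin
    toℕ (cyc (cyc i d) u)          ≡⟨ cong toℕ (cyc-cyc i d u) ⟩
    toℕ (cyc i (d ℕ.+ u))          ≡⟨ toℕ-cyc i (d ℕ.+ u) ⟩
    (toℕ i ℕ.+ (d ℕ.+ u)) % n      ≡⟨ cong (_% n) (x∙yz≈y∙xz (toℕ i) d u) ⟩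
    (d ℕ.+ (toℕ i ℕ.+ u)) % n
      ≡⟨ cong (λ v → (d ℕ.+ v) % n) (ℕP.m+[n∸m]≡n (ℕP.<⇒≤ (FinP.toℕ<n i))) ⟩
    (d ℕ.+ n) % n                  ≡⟨ [m+n]%n≡m%n d n ⟩
    d % n                          ≡⟨ m<n⇒m%n≡m d<n ⟩
    d                              ∎
    where
    u : ℕ
    u = n ∸ toℕ i

  cyc-injective : ∀ (i : Fin n) {d e} → d ℕ.< n → e ℕ.< n → cyc i d ≡ cyc i e → d ≡ e
  cyc-injective i d<n e<n same = trans (sym (cyc-unshift i d<n))
    (trans (cong (λ j → toℕ (cyc j (n ∸ toℕ i))) same) (cyc-unshift i e<n))

  next : Fin n → Fin n
  next i = cyc i 1

  prev-next : ∀ i → prev (next i) ≡ i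
  prev-next i = trans (cyc-cyc i 1 m) (trans (cyc-period i 0) (cyc-identity i))

  next-prev : ∀ i → next (prev i) ≡ i
  next-prev i = trans (cyc-cyc i m 1)
    (trans (cong (cyc i) (ℕP.+-comm m 1)) (trans (cyc-period i 0) (cyc-identity i)))

  prev-permutation : Permutation n n
  prev-permutation = permutation prev next prev-next next-prev

  sum-prev : ∀ (f : Fin n → ℚ) → ∑[ i < n ] f (prev i) ≡ sum f
  sum-prev f = sym (sum-permute f prev-permutation)

  prev-cyc-suc : ∀ (i : Fin n) d → prev (cyc i (suc d)) ≡ cyc i d
  prev-cyc-suc i d =
    trans (cyc-cyc i (suc d) m) (trans (cong (cyc i) (sym (ℕP.+-suc d m))) (cyc-period i d))

  cyc-prev-suc : ∀ (i : Fin n) d → cyc (prev i) (suc d) ≡ cyc i d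
  cyc-prev-suc i d = trans (cyc-cyc i m (suc d))
    (trans (cong (cyc i) (trans (ℕP.+-comm m (suc d)) (sym (ℕP.+-suc d m)))) (cyc-period i d))

  -- π_i without its last test prev i; it is also π_{prev i} without its first test.
  rest : Fin n → List (Fin n)
  rest i = applyUpTo (cyc i) m

  cycOrder-snoc : ∀ i → cycOrder i ≡ rest i ++ [ prev i ]
  cycOrder-snoc i = trans (ListP.map-upTo (cyc i) n) (sym (ListP.applyUpTo-∷ʳ (cyc i) m))

  cycOrder-prev : ∀ i → cycOrder (prev i) ≡ prev i ∷ rest i
  cycOrder-prev i =
    trans (ListP.map-upTo (cyc (prev i)) n) (cong₂ _∷_ (cyc-identity (prev i)) shifted)
    where
    shifted : applyUpTo (λ d → cyc (prev i) (suc d)) m ≡ rest i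
    shifted = trans (sym (ListP.map-upTo (λ d → cyc (prev i) (suc d)) m))
                    (trans (ListP.map-cong (cyc-prev-suc i) (upTo m)) (ListP.map-upTo (cyc i) m))

  prev-∉-rest : ∀ i → All (_≢ prev i) (rest i)
  prev-∉-rest i = applyUpTo⁺₁ (cyc i) m
    (λ {d} d<m same → ℕP.<-irrefl (cyc-injective i (ℕP.m<n⇒m<1+n d<m) (ℕP.n<1+n m) same) d<m)

  zerosIn-rotate : ∀ (x : Item n) i → zerosIn x (cycOrder (prev i)) ≡ zerosIn x (cycOrder i)
  zerosIn-rotate x i = begin
    zerosIn x (cycOrder (prev i))                 ≡⟨ cong (zerosIn x) (cycOrder-prev i) ⟩
    zeroBit (x (prev i)) ℕ.+ zerosIn x (rest i)   ≡⟨ ℕP.+-comm _ (zerosIn x (rest i)) ⟩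
    zerosIn x (rest i) ℕ.+ zeroBit (x (prev i))   ≡⟨ zerosIn-snoc x (rest i) (prev i) ⟨
    zerosIn x (rest i ++ [ prev i ])              ≡⟨ cong (zerosIn x) (cycOrder-snoc i) ⟨
    zerosIn x (cycOrder i)                        ∎

  zerosIn-cycOrder-zero : ∀ (x : Item n) → zerosIn x (cycOrder zero) ≡ numZeros x
  zerosIn-cycOrder-zero x = begin
    zerosIn x (map (cyc zero) (upTo n))         ≡⟨ cong (zerosIn x) (ListP.map-upTo (cyc zero) n) ⟩
    zerosIn x (applyUpTo (cyc zero) n)          ≡⟨ cong (zerosIn x) (applyUpTo-tabulate (cyc zero) n) ⟩
    zerosIn x (tabulate (λ (i : Fin n) → cyc zero (toℕ i)))
                                                ≡⟨ cong (zerosIn x) (ListP.tabulate-cong cyc-from-zero) ⟩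
    zerosIn x (tabulate (λ (i : Fin n) → i))    ≡⟨ zerosIn-tabulate x (λ i → i) ⟩
    numZeros x                                  ∎

  zerosIn-cycOrder : ∀ (x : Item n) i → zerosIn x (cycOrder i) ≡ numZeros x
  zerosIn-cycOrder x i =
    subst (λ j → zerosIn x (cycOrder j) ≡ numZeros x) (cyc-from-zero i) (from-zero (toℕ i))
    where
    from-zero : ∀ d → zerosIn x (cycOrder (cyc zero d)) ≡ numZeros x
    from-zero zero    =
      trans (cong (λ j → zerosIn x (cycOrder j)) (cyc-identity zero)) (zerosIn-cycOrder-zero x)
    from-zero (suc d) = begin
      zerosIn x (cycOrder (cyc zero (suc d)))
        ≡⟨ zerosIn-rotate x (cyc zero (suc d)) ⟨
      zerosIn x (cycOrder (prev (cyc zero (suc d))))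
        ≡⟨ cong (λ j → zerosIn x (cycOrder j)) (prev-cyc-suc zero d) ⟩
      zerosIn x (cycOrder (cyc zero d))
        ≡⟨ from-zero d ⟩
      numZeros x
        ∎

<ᵇ-suc-not : ∀ z k → (z <ᵇ suc k) ≡ not (k <ᵇ z)
<ᵇ-suc-not zero    k       = refl
<ᵇ-suc-not (suc z) zero    = refl
<ᵇ-suc-not (suc z) (suc k) = <ᵇ-suc-not z k

-- The local step of the telescoping argument, in Boolean form.  For the
-- strategy T_i write π_i = L ++ [j] (so π_j = j ∷ L), a for the outcome of
-- test j, e for "j is ℓ", A_b for "ℓ is performed along L with budget b",
-- and Z for the number of zeros on L.  Then ℓ is never in L when e holds,
-- and the item has Z + zeroBit a zeros.  If j ≠ ℓ both sides only see
-- whether ℓ is reached inside L; if j = ℓ the identity reduces to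
-- [Z ≤ k] + [k < Z] = 1 (for a = 1) and [Z < k] + [k ≤ Z] = 1 (for a = 0).
step-indicator : ∀ a e A₁ A₀ Z k → (e ≡ true → A₁ ≡ false) → (e ≡ true → A₀ ≡ false) →
  ind (not a ∧ (A₁ ∨ (e ∧ (Z <ᵇ suc k)))) + ind (e ∨ (if a then A₁ else A₀))
  ≡ (ind (not a ∧ (A₀ ∨ (e ∧ (Z <ᵇ k)))) + ind (e ∧ (k <ᵇ Z ℕ.+ zeroBit a)))
    + ind (A₁ ∨ (e ∧ (Z <ᵇ suc k)))
step-indicator true  false true  A₀    Z k _ _ = refl
step-indicator true  false false A₀    Z k _ _ = refl
step-indicator false false true  true  Z k _ _ = refl
step-indicator false false true  false Z k _ _ = refl
step-indicator false false false true  Z k _ _ = refl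
step-indicator false false false false Z k _ _ = refl
step-indicator a     true  A₁    A₀    Z k ℓ∉A₁ ℓ∉A₀
  rewrite ℓ∉A₁ refl | ℓ∉A₀ refl = at-ℓ a
  where
  at-ℓ : ∀ a → ind (not a ∧ (Z <ᵇ suc k)) + 1ℚ
               ≡ (ind (not a ∧ (Z <ᵇ k)) + ind (k <ᵇ Z ℕ.+ zeroBit a)) + ind (Z <ᵇ suc k)
  at-ℓ true  rewrite ℕP.+-identityʳ Z | <ᵇ-suc-not Z k with k <ᵇ Z
  ... | true  = refl
  ... | false = refl
  at-ℓ false rewrite ℕP.+-comm Z 1 | <ᵇ-suc-not k Z with Z <ᵇ k | Z <ᵇ suc k
  ... | true  | true  = refl
  ... | true  | false = refl
  ... | false | true  = refl
  ... | false | false = refl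

module _ {m : ℕ} (ℓ : Fin (suc m)) where

  private
    n : ℕ
    n = suc m

  isℓ : Fin n → Bool
  isℓ j = does (j ≟ ℓ)

  hits : Item n → ℕ → Fin n → Bool
  hits x k i = any isℓ (performed x k (cycOrder i))

  hits-split : ∀ (x : Item n) k i → hits x k i
               ≡ any isℓ (performed x k (rest i)) ∨ (isℓ (prev i) ∧ (zerosIn x (rest i) <ᵇ k))
  hits-split x k i = trans (cong (λ L → any isℓ (performed x k L)) (cycOrder-snoc i))
                           (hits-snoc isℓ x k (rest i) (prev i))

  hits-prev : ∀ (x : Item n) k i → hits x (suc k) (prev i)
              ≡ isℓ (prev i) ∨ (if x (prev i) then any isℓ (performed x (suc k) (rest i))
                                               else any isℓ (performed x k (rest i)))
  hits-prev x k i = trans (cong (λ L → any isℓ (performed x (suc k) L)) (cycOrder-prev i))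
                          (hits-cons isℓ x k (prev i) (rest i))

  ℓ-∉-rest : ∀ (x : Item n) k i → isℓ (prev i) ≡ true → any isℓ (performed x k (rest i)) ≡ false
  ℓ-∉-rest x k i prev-is-ℓ = hits-outside isℓ x k (rest i) (any-≟-false ℓ ℓ-avoided)
    where
    ℓ-avoided : All (_≢ ℓ) (rest i)
    ℓ-avoided = subst (λ j → All (_≢ j) (rest i)) (≟-sound (prev i) ℓ prev-is-ℓ) (prev-∉-rest i)

  hits-local : ∀ k i (x y : Item n) → (∀ j → j ≢ prev i → x j ≡ y j) → hits x k i ≡ hits y k i
  hits-local k i x y agree = begin
    hits x k i
      ≡⟨ hits-split x k i ⟩
    any isℓ (performed x k (rest i)) ∨ (isℓ (prev i) ∧ (zerosIn x (rest i) <ᵇ k))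
      ≡⟨ cong₂ (λ P Z → any isℓ P ∨ (isℓ (prev i) ∧ (Z <ᵇ k)))
               (performed-local x y k (rest i) agree-on-rest)
               (zerosIn-local x y (rest i) agree-on-rest) ⟩
    any isℓ (performed y k (rest i)) ∨ (isℓ (prev i) ∧ (zerosIn y (rest i) <ᵇ k))
      ≡⟨ hits-split y k i ⟨
    hits y k i
      ∎
    where
    agree-on-rest : All (λ j → x j ≡ y j) (rest i)
    agree-on-rest = All.map (λ {j} → agree j) (prev-∉-rest i)

  numZeros-split : ∀ (x : Item n) i → numZeros x ≡ zerosIn x (rest i) ℕ.+ zeroBit (x (prev i))
  numZeros-split x i = trans (sym (zerosIn-cycOrder x i))
    (trans (cong (zerosIn x) (cycOrder-snoc i)) (zerosIn-snoc x (rest i) (prev i)))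

  hits-step : ∀ (x : Item n) k i →
    ind (not (x (prev i)) ∧ hits x (suc k) i) + ind (hits x (suc k) (prev i))
    ≡ (ind (not (x (prev i)) ∧ hits x k i) + ind (isℓ (prev i) ∧ (k <ᵇ numZeros x)))
      + ind (hits x (suc k) i)
  hits-step x k i = begin
    ind (not a ∧ hits x (suc k) i) + ind (hits x (suc k) (prev i))
      ≡⟨ cong₂ (λ u v → ind (not a ∧ u) + ind v) (hits-split x (suc k) i) (hits-prev x k i) ⟩
    ind (not a ∧ (A₁ ∨ (e ∧ (Z <ᵇ suc k)))) + ind (e ∨ (if a then A₁ else A₀))
      ≡⟨ step-indicator a e A₁ A₀ Z k (ℓ-∉-rest x (suc k) i) (ℓ-∉-rest x k i) ⟩
    (ind (not a ∧ (A₀ ∨ (e ∧ (Z <ᵇ k)))) + ind (e ∧ (k <ᵇ Z ℕ.+ zeroBit a)))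
      + ind (A₁ ∨ (e ∧ (Z <ᵇ suc k)))
      ≡⟨ cong₂ (λ u v → (ind (not a ∧ u) + ind (e ∧ (k <ᵇ v))) + ind (A₁ ∨ (e ∧ (Z <ᵇ suc k))))
               (sym (hits-split x k i)) (sym (numZeros-split x i)) ⟩
    (ind (not a ∧ hits x k i) + ind (e ∧ (k <ᵇ numZeros x))) + ind (A₁ ∨ (e ∧ (Z <ᵇ suc k)))
      ≡⟨ cong (λ u → (ind (not a ∧ hits x k i) + ind (e ∧ (k <ᵇ numZeros x))) + ind u)
              (sym (hits-split x (suc k) i)) ⟩
    (ind (not a ∧ hits x k i) + ind (e ∧ (k <ᵇ numZeros x))) + ind (hits x (suc k) i)
      ∎
    where
    a e A₁ A₀ : Bool
    a  = x (prev i)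
    e  = isℓ (prev i)
    A₁ = any isℓ (performed x (suc k) (rest i))
    A₀ = any isℓ (performed x k (rest i))
    Z : ℕ
    Z  = zerosIn x (rest i)

  count : Item n → ℕ → ℚ
  count x k = ∑[ i < n ] ind (not (x (prev i)) ∧ hits x k i)

  -- Summing hits-step over i, the terms ind (hits x (suc k) _) telescope
  -- along the cyclic shift and the indicator of prev i = ℓ sums to one term.
  count-suc : ∀ (x : Item n) k → count x (suc k) ≡ count x k + ind (k <ᵇ numZeros x)
  count-suc x k = ∙-cancelʳ P (count x (suc k)) (count x k + ind c) (begin
    count x (suc k) + P
      ≡⟨ cong (count x (suc k) +_) (sum-prev H) ⟨
    count x (suc k) + ∑[ i < n ] H (prev i)
      ≡⟨ ∑-distrib-+ (λ i → ind (not (x (prev i)) ∧ hits x (suc k) i)) (λ i → H (prev i)) ⟨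
    ∑[ i < n ] (ind (not (x (prev i)) ∧ hits x (suc k) i) + H (prev i))
      ≡⟨ sum-cong-≗ (hits-step x k) ⟩
    ∑[ i < n ] ((ind (not (x (prev i)) ∧ hits x k i) + ind (isℓ (prev i) ∧ c)) + H i)
      ≡⟨ ∑-distrib-+ (λ i → ind (not (x (prev i)) ∧ hits x k i) + ind (isℓ (prev i) ∧ c)) H ⟩
    ∑[ i < n ] (ind (not (x (prev i)) ∧ hits x k i) + ind (isℓ (prev i) ∧ c)) + P
      ≡⟨ cong (_+ P) (∑-distrib-+ (λ i → ind (not (x (prev i)) ∧ hits x k i))
                                  (λ i → ind (isℓ (prev i) ∧ c))) ⟩
    (count x k + ∑[ i < n ] ind (isℓ (prev i) ∧ c)) + P
      ≡⟨ cong (λ u → (count x k + u) + P)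
              (trans (sum-prev (λ j → ind (isℓ j ∧ c))) (sum-indicator ℓ c)) ⟩
    (count x k + ind c) + P
      ∎)
    where
    c : Bool
    c = k <ᵇ numZeros x
    H : Fin n → ℚ
    H i = ind (hits x (suc k) i)
    P : ℚ
    P = sum H

  count-formula : ∀ (x : Item n) k →
                  count x k ≡ sumList (map (λ t → ind (t <ᵇ numZeros x)) (upTo k))
  count-formula x zero =
    trans (sum-cong-≗ (λ i → cong ind (BoolP.∧-zeroʳ (not (x (prev i)))))) (sum-replicate-zero n)
  count-formula x (suc k) = begin
    count x (suc k)                         ≡⟨ count-suc x k ⟩
    count x k + ind (k <ᵇ numZeros x)       ≡⟨ cong (_+ ind (k <ᵇ numZeros x)) (count-formula x k) ⟩
    sumList (map h (upTo k)) + h k          ≡⟨ sumList-upTo-suc h k ⟨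
    sumList (map h (upTo (suc k)))          ∎
    where
    h : ℕ → ℚ
    h t = ind (t <ᵇ numZeros x)

module _ {m : ℕ} (p : Fin (suc m) → ℚ) (k : ℕ) (ℓ : Fin (suc m)) where

  private
    n : ℕ
    n = suc m

  load-term : ∀ i → g p k (cycOrder i) ℓ * (1ℚ - p (prev i))
                    ≡ Ex p (λ x → ind (not (x (prev i)) ∧ hits ℓ x k i))
  load-term i = begin
    g p k (cycOrder i) ℓ * (1ℚ - p (prev i))
      ≡⟨ ℚP.*-comm (g p k (cycOrder i) ℓ) (1ℚ - p (prev i)) ⟩
    (1ℚ - p (prev i)) * Pr p (λ x → hits ℓ x k i)
      ≡⟨ cong ((1ℚ - p (prev i)) *_) (Pr≡Ex p (λ x → hits ℓ x k i)) ⟩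
    (1ℚ - p (prev i)) * Ex p (λ x → ind (hits ℓ x k i))
      ≡⟨ Ex-indep p (prev i) (λ x → ind (hits ℓ x k i))
                  (λ x y agree → cong ind (hits-local ℓ k i x y agree)) ⟨
    Ex p (λ x → ind (not (x (prev i))) * ind (hits ℓ x k i))
      ≡⟨ Ex-cong p (λ x → sym (ind-∧ (not (x (prev i))) (hits ℓ x k i))) ⟩
    Ex p (λ x → ind (not (x (prev i)) ∧ hits ℓ x k i))
      ∎

  load-identity : ∑[ i < n ] (g p k (cycOrder i) ℓ * (1ℚ - p (prev i))) ≡ alpha p k
  load-identity = begin
    ∑[ i < n ] (g p k (cycOrder i) ℓ * (1ℚ - p (prev i)))
      ≡⟨ sum-cong-≗ load-term ⟩
    ∑[ i < n ] Ex p (λ x → ind (not (x (prev i)) ∧ hits ℓ x k i))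
      ≡⟨ Ex-∑ p n (λ i x → ind (not (x (prev i)) ∧ hits ℓ x k i)) ⟩
    Ex p (λ x → count ℓ x k)
      ≡⟨ Ex-cong p (λ x → count-formula ℓ x k) ⟩
    Ex p (λ x → sumList (map (λ t → ind (t <ᵇ numZeros x)) (upTo k)))
      ≡⟨ Ex-sumList p (upTo k) (λ t x → ind (t <ᵇ numZeros x)) ⟨
    sumList (map (λ t → Ex p (λ x → ind (t <ᵇ numZeros x))) (upTo k))
      ≡⟨ sumList-map-cong (λ t → sym (Pr≡Ex p (λ x → t <ᵇ numZeros x))) (upTo k) ⟩
    alpha p k
      ∎

  routing-load : ∀ (z : Fin n → ℚ) c s → (∀ i → z i * c ≡ s * (1ℚ - p (prev i))) →
                 (∑[ i < n ] (g p k (cycOrder i) ℓ * z i)) * c ≡ s * alpha p k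
  routing-load z c s proportional = begin
    (∑[ i < n ] (G i * z i)) * c
      ≡⟨ *-distribʳ-sum c (λ i → G i * z i) ⟩
    ∑[ i < n ] (G i * z i * c)
      ≡⟨ sum-cong-≗ (λ i → trans (ℚP.*-assoc (G i) (z i) c) (cong (G i *_) (proportional i))) ⟩
    ∑[ i < n ] (G i * (s * q i))
      ≡⟨ sum-cong-≗ (λ i → *-exchange (G i) s (q i)) ⟩
    ∑[ i < n ] (s * (G i * q i))
      ≡⟨ *-distribˡ-sum s (λ i → G i * q i) ⟨
    s * ∑[ i < n ] (G i * q i)
      ≡⟨ cong (s *_) load-identity ⟩
    s * alpha p k
      ∎
    where
    G q : Fin n → ℚ
    G i = g p k (cycOrder i) ℓ
    q i = 1ℚ - p (prev i)

-- α > 0 as soon as k ≥ 1: already Pr[N ≥ 1] ≥ Pr[x_1 = 0] > 0.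
alpha-pos : ∀ {m} (p : Fin (suc m) → ℚ) k → (∀ i → 0ℚ < p i) → (∀ i → p i < 1ℚ) →
            0ℚ < alpha p (suc k)
alpha-pos {m} p k 0<p p<1 = ℚP.+-mono-<-≤ some-zero-pos other-terms-nonneg
  where
  p′ : Fin m → ℚ
  p′ i = p (suc i)
  0≤p : ∀ i → 0ℚ ≤ℚ p i
  0≤p i = ℚP.<⇒≤ (0<p i)
  0≤1-p : ∀ i → 0ℚ ≤ℚ 1ℚ - p i
  0≤1-p i = ℚP.<⇒≤ (0<1-p (p<1 i))
  B : ℚ
  B = Ex p′ (λ y → ind (0 <ᵇ numZeros (true ∷ᵥ y)))
  some-zero : Pr p (λ x → 0 <ᵇ numZeros x) ≡ (1ℚ - p zero) * 1ℚ + p zero * B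
  some-zero = begin
    Pr p (λ x → 0 <ᵇ numZeros x)
      ≡⟨ Pr≡Ex p (λ x → 0 <ᵇ numZeros x) ⟩
    Ex p (λ x → ind (0 <ᵇ numZeros x))
      ≡⟨ Ex-cons p (λ x → ind (0 <ᵇ numZeros x)) ⟩
    (1ℚ - p zero) * Ex p′ (λ _ → 1ℚ) + p zero * B
      ≡⟨ cong (λ u → (1ℚ - p zero) * u + p zero * B) (Ex-one p′) ⟩
    (1ℚ - p zero) * 1ℚ + p zero * B
      ∎
  some-zero-pos : 0ℚ < Pr p (λ x → 0 <ᵇ numZeros x)
  some-zero-pos = subst (0ℚ <_) (sym some-zero)
    (ℚP.+-mono-<-≤ (subst (0ℚ <_) (sym (ℚP.*-identityʳ (1ℚ - p zero))) (0<1-p (p<1 zero)))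
                   (*-nonneg (0≤p zero) B-nonneg))
    where
    B-nonneg : 0ℚ ≤ℚ B
    B-nonneg = Ex-ind-nonneg p′ (λ i → 0≤p (suc i)) (λ i → 0≤1-p (suc i))
                             (λ y → 0 <ᵇ numZeros (true ∷ᵥ y))
  Pr-nonneg : ∀ (E : Item (suc m) → Bool) → 0ℚ ≤ℚ Pr p E
  Pr-nonneg E = subst (0ℚ ≤ℚ_) (sym (Pr≡Ex p E)) (Ex-ind-nonneg p 0≤p 0≤1-p E)
  other-terms-nonneg :
    0ℚ ≤ℚ sumList (map (λ t → Pr p (λ x → suc t ≤ᵇ numZeros x)) (applyUpTo suc k))
  other-terms-nonneg = sumList-map-nonneg (λ t → Pr p (λ x → suc t ≤ᵇ numZeros x))
    (λ t → Pr-nonneg (λ x → suc t ≤ᵇ numZeros x)) (applyUpTo suc k)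

lemma3 : (n k : ℕ) → 1 ≤ k → k ≤ n → (p : Fin n → ℚ) →
         (∀ i → 0ℚ < p i) → (∀ i → p i < 1ℚ) →
         ((t : ℚ) → 0ℚ ≤ℚ t → (z : Fin n → ℚ) →
            (∀ i → z i * ΣFin (λ j → 1ℚ - p (prev j)) ≡ t * (1ℚ - p (prev i))) →
            ∀ ℓ → ΣFin (λ i → g p k (cycOrder i) ℓ * z i) * ΣFin (λ j → 1ℚ - p j)
                  ≡ t * alpha p k)
         ×
         ((r : ℚ) → 0ℚ < r → (z : Fin n → ℚ) →
            (∀ i → z i * alpha p k ≡ r * (1ℚ - p (prev i))) →
            ∀ ℓ → ΣFin (λ i → g p k (cycOrder i) ℓ * z i) ≡ r)
lemma3 _       zero    ()  _   _ _   _
lemma3 zero    (suc k) _   ()  _ _   _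
lemma3 (suc m) (suc k) _   _   p 0<p p<1 = proportional-load , equal-rates-saturate
  where
  q : Fin (suc m) → ℚ
  q j = 1ℚ - p j
  load : (Fin (suc m) → ℚ) → Fin (suc m) → ℚ
  load z ℓ = ΣFin (λ i → g p (suc k) (cycOrder i) ℓ * z i)
  load≡sum : ∀ z ℓ → load z ℓ ≡ ∑[ i < suc m ] (g p (suc k) (cycOrder i) ℓ * z i)
  load≡sum z ℓ = ΣFin≡sum (λ i → g p (suc k) (cycOrder i) ℓ * z i)

  proportional-load : (t : ℚ) → 0ℚ ≤ℚ t → (z : Fin (suc m) → ℚ) →
                      (∀ i → z i * ΣFin (λ j → q (prev j)) ≡ t * q (prev i)) →
                      ∀ ℓ → load z ℓ * ΣFin q ≡ t * alpha p (suc k)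
  proportional-load t _ z proportional ℓ = begin
    load z ℓ * ΣFin q
      ≡⟨ cong₂ _*_ (load≡sum z ℓ) (trans (ΣFin≡sum q) (sym (sum-prev q))) ⟩
    (∑[ i < suc m ] (g p (suc k) (cycOrder i) ℓ * z i)) * ∑[ j < suc m ] q (prev j)
      ≡⟨ routing-load p (suc k) ℓ z (∑[ j < suc m ] q (prev j)) t
           (λ i → trans (cong (z i *_) (sym (ΣFin≡sum (λ j → q (prev j))))) (proportional i)) ⟩
    t * alpha p (suc k)
      ∎

  equal-rates-saturate : (r : ℚ) → 0ℚ < r → (z : Fin (suc m) → ℚ) →
                         (∀ i → z i * alpha p (suc k) ≡ r * q (prev i)) →
                         ∀ ℓ → load z ℓ ≡ r
  equal-rates-saturate r _ z proportional ℓ = trans (load≡sum z ℓ)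
    (*-cancelʳ-≢0 (alpha p (suc k)) (λ α≡0 → ℚP.<⇒≢ (alpha-pos p k 0<p p<1) (sym α≡0))
                  (routing-load p (suc k) ℓ z (alpha p (suc k)) r proportional))
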